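{- Let $n\ge3$ and $k\ge0$. For $2\le i<n$, we have $v_k(t_{i,n})\le v_k(t_{i+1,n})$, where $t_{i,n}$ is the standard tableau of shape $(n-1,1)$ with first row $1,\dots,i-1,i+1,\dots,n$ and second row $i$. In other words, $i\mapsto v_k(t_{i,n})$ is weakly increasing.
   Context: Tableaux use the French convention: row 1 at the bottom, and the box in row $i$, column $j$ has diagonal index $j-i$. In a standard tableau of size $m$, an entry $i$ is an ascent if $i=m$ or $i+1$ is in a row of index at most that of $i$. A derangement tableau is one that is empty or whose smallest ascent is even. Schützenberger's $\Delta$. Delete $1$ from $t$. Slide the empty box by swapping it with the smaller of the entries directly above and directly to the right (among those present), until it reaches an outer corner. Remove it and decrease all entries by $1$; the result is $\Delta(t)$. The removed box is $t/\Delta(t)$, with diagonal index $\mathrm{diag}(t/\Delta(t))$. $\mathrm{type}(t)$ is the least $j\ge0$ with $\Delta^j(t)$ a derangement tableau. Recursion. $v_0(t)=1$. For $k\ge1$ and $t$ of size $m$: $v_k(t)=0$ if $\mathrm{type}(t)<k$, and otherwise $v_k(t)=v_k(\Delta(t))+(m+1-k+\mathrm{diag}(t/\Delta(t)))v_{k-1}(\Delta(t))$. -}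

module Defs where

open import Data.Nat using (ℕ; zero; suc; _+_; _∸_; _<ᵇ_; _≤ᵇ_; _≡ᵇ_; _%_)
open import Data.Integer using (ℤ; +_; _-_; _*_) renaming (_+_ to _+ℤ_)
open import Data.Bool using (Bool; true; false; if_then_else_; _∨_; not)
open import Data.List using (List; []; _∷_; length; map; upTo; filterᵇ)
open import Data.Nat.ListAction using (sum)
open import Data.Maybe using (Maybe; just; nothing)
open import Data.Product using (_×_; _,_; proj₁; proj₂)

-- A (French) tableau is a list of rows, row 1 (bottom) first.
-- Positions (r , c) below are 0-indexed (row r+1, column c+1 in the paper);
-- the diagonal index c - r is the same in both conventions.
Tableau : Set
Tableau = List (List ℕ)

size : Tableau → ℕ
size t = sum (map length t)

lookupL : {A : Set} → List A → ℕ → Maybe A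
lookupL []       _       = nothing
lookupL (x ∷ xs) zero    = just x
lookupL (x ∷ xs) (suc n) = lookupL xs n

modifyAt : {A : Set} → ℕ → (A → A) → List A → List A
modifyAt _       f []       = []
modifyAt zero    f (x ∷ xs) = f x ∷ xs
modifyAt (suc n) f (x ∷ xs) = x ∷ modifyAt n f xs

entry : Tableau → ℕ → ℕ → Maybe ℕ
entry t r c with lookupL t r
... | nothing  = nothing
... | just row = lookupL row c

setEntry : Tableau → ℕ → ℕ → ℕ → Tableau
setEntry t r c x = modifyAt r (modifyAt c (λ _ → x)) t

-- 0-indexed row containing the entry x (0 if absent)
rowOf : Tableau → ℕ → ℕ
rowOf t x = go 0 t
  where
  mem : List ℕ → Bool
  mem []       = false
  mem (y ∷ ys) = (y ≡ᵇ x) ∨ mem ys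
  go : ℕ → Tableau → ℕ
  go r []         = 0
  go r (row ∷ rs) = if mem row then r else go (suc r) rs

isAscent : Tableau → ℕ → Bool
isAscent t i = (i ≡ᵇ size t) ∨ (rowOf t (suc i) ≤ᵇ rowOf t i)

-- smallest ascent (search i = 1, 2, …, m; m is always an ascent)
minAscent : Tableau → ℕ
minAscent t = go 1 (size t)
  where
  go : ℕ → ℕ → ℕ
  go i zero    = size t
  go i (suc f) = if isAscent t i then i else go (suc i) f

isDerangement : Tableau → Bool
isDerangement t = (size t ≡ᵇ 0) ∨ (minAscent t % 2 ≡ᵇ 0)

dropLast : List ℕ → List ℕ
dropLast []           = []
dropLast (x ∷ [])     = []
dropLast (x ∷ y ∷ xs) = x ∷ dropLast (y ∷ xs)

nonEmpty : List ℕ → Bool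
nonEmpty [] = false
nonEmpty (_ ∷ _) = true

removeBox : Tableau → ℕ → Tableau
removeBox t r = filterᵇ nonEmpty (modifyAt r dropLast t)

-- jeu de taquin slide of the empty box at (r , c); returns the tableau with
-- the empty box removed together with the final position of the empty box.
-- The fuel (size of the tableau) bounds the number of slide steps.
slide : ℕ → Tableau → ℕ → ℕ → Tableau × (ℕ × ℕ)
slide zero    t r c = removeBox t r , (r , c)
slide (suc f) t r c with entry t (suc r) c | entry t r (suc c)
... | nothing | nothing = removeBox t r , (r , c)
... | just x  | nothing = slide f (setEntry (setEntry t r c x) (suc r) c 0) (suc r) c
... | nothing | just y  = slide f (setEntry (setEntry t r c y) r (suc c) 0) r (suc c)
... | just x  | just y  =
  if x <ᵇ y
  then slide f (setEntry (setEntry t r c x) (suc r) c 0) (suc r) c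
  else slide f (setEntry (setEntry t r c y) r (suc c) 0) r (suc c)

-- Schützenberger's Δ, together with diag(t / Δ(t)).
-- The entry 1 of a standard tableau sits in the box (row 1, column 1).
Δd : Tableau → Tableau × ℤ
Δd t with size t ≡ᵇ 0
... | true  = [] , + 0
... | false with slide (size t) (setEntry t 0 0 0) 0 0
...   | t' , (r , c) = map (map (λ x → x ∸ 1)) t' , (+ c - + r)

Δ : Tableau → Tableau
Δ t = proj₁ (Δd t)

diagRemoved : Tableau → ℤ
diagRemoved t = proj₂ (Δd t)

-- type(t) = least j ≥ 0 with Δ^j(t) a derangement tableau
-- (size decreases under Δ and the empty tableau is a derangement tableau,
--  so fuel size t + 1 suffices)
typeAux : ℕ → Tableau → ℕ
typeAux zero    t = 0
typeAux (suc f) t = if isDerangement t then 0 else suc (typeAux f (Δ t))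

type : Tableau → ℕ
type t = typeAux (suc (size t)) t

-- v_k(t) by the recursion in the paper; fuel = size t (Δ lowers size by 1)
vAux : ℕ → ℕ → Tableau → ℤ
vAux _       zero    t = + 1
vAux zero    (suc k) t = + 0
vAux (suc f) (suc k) t =
  if type t <ᵇ suc k then + 0
  else (vAux f (suc k) (Δ t)
        +ℤ ((+ (size t + 1) - + (suc k) +ℤ diagRemoved t) * vAux f k (Δ t)))

v : ℕ → Tableau → ℤ
v k t = vAux (size t) k t

tab : ℕ → ℕ → Tableau
tab i n = filterᵇ (λ j → not (j ≡ᵇ i)) (map suc (upTo n)) ∷ (i ∷ []) ∷ []

module Submission where

-- The proof computes v_k on these tableaux explicitly.
--   * Sliding: for i ≥ 3 the empty box left by deleting 1 runs along the
--     first row, so Δ(t_{i,n}) = t_{i-1,n-1} and diag(t/Δt) = n - 2.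
--   * Types: t_{2,n} is a derangement tableau (its smallest ascent is 2),
--     hence type(t_{i,n}) = i - 2.
--   * So W k j m = v_k(t_{j+2,m+2}) satisfies W_{k+1}(0,m) = 0 and, for
--     j ≤ m, W_{k+1}(j+1,m+1) = 0 if j < k and otherwise
--     W_{k+1}(j,m) + c_k(m) W_k(j,m), where c_k(m) = (m+4) - (k+1) + (m+1).

open import Defs
open import Data.Nat using (ℕ; suc; _≤_; _<_)
open import Data.Integer using () renaming (_≤_ to _≤ℤ_)
open import Data.Nat using (zero; _+_; _∸_; _≡ᵇ_; _<ᵇ_; _≤ᵇ_; _≤?_; z≤n; s≤s)
open import Data.Nat.Properties
  using (≡ᵇ⇒≡; ≡⇒≡ᵇ; <ᵇ⇒<; <⇒<ᵇ; ≤-refl; ≤-trans; <⇒≤; ≤⇒≯; ≰⇒>; >⇒≢; ≤∧≢⇒<; <⇒≱; _≟_;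
         m≤n⇒m≤1+n; m≤m+n; +-comm; +-suc; +-identityʳ)
open import Data.Integer using (ℤ; +_; _*_; +≤+; NonNegative; nonNegative)
  renaming (_+_ to _+ℤ_; _-_ to _-ℤ_)
import Data.Integer.Properties as ℤP
open import Data.Bool using (true; false; not; if_then_else_)
open import Data.Bool.Properties using (T-≡; ¬-not)
open import Data.Maybe using (just; nothing)
open import Data.List using (List; []; _∷_; _++_; length; map; filterᵇ; applyUpTo)
open import Data.List.Properties using (++-assoc; ++-identityʳ; length-++; map-upTo)
open import Data.Product using (_,_; proj₁; proj₂)
open import Function.Bundles using (Equivalence)
open import Relation.Nullary using (yes; no; contradiction)
open import Relation.Binary.PropositionalEquality
  using (_≡_; _≢_; refl; sym; trans; cong; cong₂; subst; subst₂; module ≡-Reasoning)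

open Equivalence using (to; from)

0≤-* : ∀ {a b : ℤ} → + 0 ≤ℤ a → + 0 ≤ℤ b → + 0 ≤ℤ a * b
0≤-* {a} {b} 0≤a 0≤b =
  subst (_≤ℤ a * b) (ℤP.*-zeroʳ a) (ℤP.*-monoˡ-≤-nonNeg a {{nonNegative 0≤a}} 0≤b)

module MonotoneRecurrence
  (W : ℕ → ℕ → ℕ → ℤ) (c : ℕ → ℕ → ℤ)
  (c-nonneg : ∀ {k m} → k ≤ m → + 0 ≤ℤ c k m)
  (W-zero : ∀ j m → W 0 j m ≡ + 1)
  (W-base : ∀ k m → W (suc k) 0 m ≡ + 0)
  (W-vanish : ∀ {k j m} → j ≤ m → j < k → W (suc k) (suc j) (suc m) ≡ + 0)
  (W-step : ∀ {k j m} → j ≤ m → k ≤ j →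
            W (suc k) (suc j) (suc m) ≡ W (suc k) j m +ℤ c k m * W k j m)
  where

  W-nonneg : ∀ k j m → j ≤ m → + 0 ≤ℤ W k j m
  W-nonneg zero    j       m       _         = subst (+ 0 ≤ℤ_) (sym (W-zero j m)) (+≤+ z≤n)
  W-nonneg (suc k) zero    m       _         = ℤP.≤-reflexive (sym (W-base k m))
  W-nonneg (suc k) (suc j) (suc m) (s≤s j≤m) with k ≤? j
  ... | yes k≤j = subst (+ 0 ≤ℤ_) (sym (W-step j≤m k≤j))
                    (ℤP.+-mono-≤ (W-nonneg (suc k) j m j≤m)
                                 (0≤-* (c-nonneg (≤-trans k≤j j≤m)) (W-nonneg k j m j≤m)))
  ... | no  k≰j = ℤP.≤-reflexive (sym (W-vanish j≤m (≰⇒> k≰j)))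

  W-mono : ∀ k j m → suc j ≤ m → W k j m ≤ℤ W k (suc j) m
  W-mono zero    j       m       _            =
    ℤP.≤-reflexive (trans (W-zero j m) (sym (W-zero (suc j) m)))
  W-mono (suc k) zero    m       1≤m          =
    subst (_≤ℤ W (suc k) 1 m) (sym (W-base k m)) (W-nonneg (suc k) 1 m 1≤m)
  W-mono (suc k) (suc j) (suc m) (s≤s 1+j≤m) with k ≤? j
  ... | yes k≤j = subst₂ _≤ℤ_ (sym (W-step (<⇒≤ 1+j≤m) k≤j)) (sym (W-step 1+j≤m (m≤n⇒m≤1+n k≤j)))
                    (ℤP.+-mono-≤ (W-mono (suc k) j m 1+j≤m)
                                 (ℤP.*-monoˡ-≤-nonNeg (c k m) {{c≥0}} (W-mono k j m 1+j≤m)))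
    where
    c≥0 : NonNegative (c k m)
    c≥0 = nonNegative (c-nonneg (≤-trans k≤j (<⇒≤ 1+j≤m)))
  ... | no  k≰j = subst (_≤ℤ W (suc k) (suc (suc j)) (suc m))
                    (sym (W-vanish (<⇒≤ 1+j≤m) (≰⇒> k≰j)))
                    (W-nonneg (suc k) (suc (suc j)) (suc m) (s≤s 1+j≤m))

≡ᵇ-true : ∀ {a b} → a ≡ b → (a ≡ᵇ b) ≡ true
≡ᵇ-true {a} {b} a≡b = to T-≡ (≡⇒≡ᵇ a b a≡b)

≡ᵇ-false : ∀ {a b} → a ≢ b → (a ≡ᵇ b) ≡ false
≡ᵇ-false {a} {b} a≢b = ¬-not (λ e → a≢b (≡ᵇ⇒≡ a b (from T-≡ e)))

<ᵇ-true : ∀ {a b} → a < b → (a <ᵇ b) ≡ true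
<ᵇ-true a<b = to T-≡ (<⇒<ᵇ a<b)

<ᵇ-false : ∀ {a b} → b ≤ a → (a <ᵇ b) ≡ false
<ᵇ-false {a} {b} b≤a = ¬-not (λ e → ≤⇒≯ b≤a (<ᵇ⇒< a b (from T-≡ e)))

type-derangement : ∀ t → isDerangement t ≡ true → type t ≡ 0
type-derangement t der rewrite der = refl

type-step : ∀ t → isDerangement t ≡ false → size t ≡ suc (size (Δ t)) →
  type t ≡ suc (type (Δ t))
type-step t not-der size-Δ rewrite not-der = cong (λ s → suc (typeAux s (Δ t))) size-Δ

v-vanishes : ∀ k t → type t < suc k → v (suc k) t ≡ + 0
v-vanishes k t type<k+1 = vanishes-with-fuel (size t)
  where
  vanishes-with-fuel : ∀ f → vAux f (suc k) t ≡ + 0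
  vanishes-with-fuel zero    = refl
  vanishes-with-fuel (suc f) rewrite <ᵇ-true type<k+1 = refl

v-recursion : ∀ k t {f} → size t ≡ suc f → size (Δ t) ≡ f → suc k ≤ type t →
  v (suc k) t ≡
  v (suc k) (Δ t) +ℤ (+ (suc f + 1) -ℤ + suc k +ℤ diagRemoved t) * v k (Δ t)
v-recursion k t {f} size-t size-Δ k<type = begin
  vAux (size t) (suc k) t
    ≡⟨ cong (λ s → vAux s (suc k) t) size-t ⟩
  (if type t <ᵇ suc k then + 0 else recursive-part (size t) f)
    ≡⟨ cong (λ b → if b then + 0 else recursive-part (size t) f) (<ᵇ-false k<type) ⟩
  recursive-part (size t) f
    ≡⟨ cong₂ recursive-part size-t (sym size-Δ) ⟩
  recursive-part (suc f) (size (Δ t)) ∎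
  where
  open ≡-Reasoning
  recursive-part : ℕ → ℕ → ℤ
  recursive-part n fuel =
    vAux fuel (suc k) (Δ t) +ℤ (+ (n + 1) -ℤ + suc k +ℤ diagRemoved t) * vAux fuel k (Δ t)

twoRow : List ℕ → ℕ → Tableau
twoRow r x = r ∷ (x ∷ []) ∷ []

lookupL-after : ∀ {n} (pre : List ℕ) z zs → length pre ≡ n →
  lookupL (pre ++ z ∷ zs) (suc n) ≡ lookupL zs 0
lookupL-after []       z zs refl = refl
lookupL-after (_ ∷ ps) z zs refl = lookupL-after ps z zs refl

swap-right : ∀ {n} (pre : List ℕ) y post → length pre ≡ n →
  modifyAt (suc n) (λ _ → 0) (modifyAt n (λ _ → y) (pre ++ 0 ∷ y ∷ post)) ≡ pre ++ y ∷ 0 ∷ post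
swap-right []       y post refl = refl
swap-right (p ∷ ps) y post refl = cong (p ∷_) (swap-right ps y post refl)

dropLast-snoc : ∀ (xs : List ℕ) y → dropLast (xs ++ y ∷ []) ≡ xs
dropLast-snoc []            y = refl
dropLast-snoc (x ∷ [])      y = refl
dropLast-snoc (x ∷ x′ ∷ xs) y = cong (x ∷_) (dropLast-snoc (x′ ∷ xs) y)

removeBox-end : ∀ {c} pre x → length pre ≡ suc c →
  removeBox (twoRow (pre ++ 0 ∷ []) x) 0 ≡ twoRow pre x
removeBox-end (p ∷ ps) x _ rewrite dropLast-snoc (p ∷ ps) 0 = refl

slide-right : ∀ f t r c y → entry t (suc r) c ≡ nothing → entry t r (suc c) ≡ just y →
  slide (suc f) t r c ≡ slide f (setEntry (setEntry t r c y) r (suc c) 0) r (suc c)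
slide-right f t r c y above right rewrite above | right = refl

slide-stop : ∀ f t r c → entry t (suc r) c ≡ nothing → entry t r (suc c) ≡ nothing →
  slide (suc f) t r c ≡ (removeBox t r , (r , c))
slide-stop f t r c above right rewrite above | right = refl

-- A hole in the first row at column c+1 ≥ 1 has nothing above it (the
-- second row is a single box), so with enough fuel it slides to the end of
-- the first row; that end box, in column c+1+|post|, is removed.
slide-along-row : ∀ post f c pre x → length pre ≡ suc c → length post ≤ f →
  slide f (twoRow (pre ++ 0 ∷ post) x) 0 (suc c) ≡ (twoRow (pre ++ post) x , (0 , suc c + length post))
slide-along-row []         zero    c pre x len _ =
  cong₂ _,_ (trans (removeBox-end pre x len) (cong (λ r → twoRow r x) (sym (++-identityʳ pre))))
            (cong (0 ,_) (sym (+-identityʳ (suc c))))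
slide-along-row []         (suc f) c pre x len _ =
  trans (slide-stop f (twoRow (pre ++ 0 ∷ []) x) 0 (suc c) refl (lookupL-after pre 0 [] len))
        (slide-along-row [] zero c pre x len z≤n)
slide-along-row (y ∷ post) (suc f) c pre x len (s≤s fuel) = begin
  slide (suc f) (twoRow (pre ++ 0 ∷ y ∷ post) x) 0 (suc c)
    ≡⟨ slide-right f (twoRow (pre ++ 0 ∷ y ∷ post) x) 0 (suc c) y refl (lookupL-after pre 0 (y ∷ post) len) ⟩
  slide f (twoRow (modifyAt (suc (suc c)) (λ _ → 0)
                     (modifyAt (suc c) (λ _ → y) (pre ++ 0 ∷ y ∷ post))) x) 0 (suc (suc c))
    ≡⟨ cong (λ r → slide f (twoRow r x) 0 (suc (suc c))) swapped ⟩
  slide f (twoRow ((pre ++ y ∷ []) ++ 0 ∷ post) x) 0 (suc (suc c))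
    ≡⟨ slide-along-row post f (suc c) (pre ++ y ∷ []) x len′ fuel ⟩
  (twoRow ((pre ++ y ∷ []) ++ post) x , (0 , suc (suc c) + length post))
    ≡⟨ cong₂ _,_ (cong (λ r → twoRow r x) (++-assoc pre (y ∷ []) post))
                 (cong (0 ,_) (sym (+-suc (suc c) (length post)))) ⟩
  (twoRow (pre ++ y ∷ post) x , (0 , suc c + suc (length post))) ∎
  where
  open ≡-Reasoning
  swapped : modifyAt (suc (suc c)) (λ _ → 0) (modifyAt (suc c) (λ _ → y) (pre ++ 0 ∷ y ∷ post))
            ≡ (pre ++ y ∷ []) ++ 0 ∷ post
  swapped = trans (swap-right pre y post len) (sym (++-assoc pre (y ∷ []) (0 ∷ post)))
  len′ : length (pre ++ y ∷ []) ≡ suc (suc c)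
  len′ = trans (length-++ pre) (trans (cong (_+ 1) len) (cong suc (+-comm c 1)))

interval : ℕ → ℕ → List ℕ
interval a zero    = []
interval a (suc m) = a ∷ interval (suc a) m

without : ℕ → List ℕ → List ℕ
without i = filterᵇ (λ j → not (j ≡ᵇ i))

hook : ℕ → ℕ → Tableau
hook i n = twoRow (without i (interval 1 n)) i

applyUpTo-interval : ∀ (g : ℕ → ℕ) a n → (∀ x → g x ≡ a + x) → applyUpTo g n ≡ interval a n
applyUpTo-interval g a zero    _     = refl
applyUpTo-interval g a (suc n) g≗a+ =
  cong₂ _∷_ (trans (g≗a+ 0) (+-identityʳ a))
            (applyUpTo-interval (λ x → g (suc x)) (suc a) n (λ x → trans (g≗a+ (suc x)) (+-suc a x)))

tab≡hook : ∀ i n → tab i n ≡ hook i n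
tab≡hook i n =
  cong (λ r → twoRow (without i r) i) (trans (map-upTo suc n) (applyUpTo-interval suc 1 n (λ _ → refl)))

length-without-absent : ∀ i a m → i < a → length (without i (interval a m)) ≡ m
length-without-absent i a zero    _   = refl
length-without-absent i a (suc m) i<a rewrite ≡ᵇ-false (>⇒≢ i<a) =
  cong suc (length-without-absent i (suc a) m (m≤n⇒m≤1+n i<a))

length-without-present : ∀ i a m → a ≤ i → i < a + m → suc (length (without i (interval a m))) ≡ m
length-without-present i a zero    a≤i i<a+0 = contradiction a≤i (<⇒≱ (subst (i <_) (+-identityʳ a) i<a+0))
length-without-present i a (suc m) a≤i i<a+m with a ≟ i
... | yes refl rewrite ≡ᵇ-true (refl {x = a}) = cong suc (length-without-absent a (suc a) m (s≤s ≤-refl))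
... | no  a≢i rewrite ≡ᵇ-false a≢i =
  cong suc (length-without-present i (suc a) m (≤∧≢⇒< a≤i a≢i) (subst (i <_) (+-suc a m) i<a+m))

pred-without : ∀ i a m → map (λ x → x ∸ 1) (without (suc i) (interval (suc a) m)) ≡ without i (interval a m)
pred-without i a zero = refl
pred-without i a (suc m) with a ≡ᵇ i
... | true  = pred-without i (suc a) m
... | false = cong (a ∷_) (pred-without i (suc a) m)

hook-size : ∀ i n → 1 ≤ i → i ≤ n → size (hook i n) ≡ n
hook-size i n 1≤i i≤n =
  trans (+-comm (length (without i (interval 1 n))) 1) (length-without-present i 1 n 1≤i (s≤s i≤n))

Δd-unfold : ∀ t {t′ r c} → (size t ≡ᵇ 0) ≡ false →
  slide (size t) (setEntry t 0 0 0) 0 0 ≡ (t′ , (r , c)) →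
  Δd t ≡ (map (map (λ x → x ∸ 1)) t′ , + c -ℤ + r)
Δd-unfold t nonempty slid rewrite nonempty | slid = refl

-- For i = j+3: the hole left by 1 first moves right past 2 (the entry i
-- above it is larger), then runs to the end of the first row, in column
-- n-2 = m+1; decrementing gives t_{i-1,n-1}.
Δd-hook : ∀ j m → j ≤ m → Δd (hook (3 + j) (3 + m)) ≡ (hook (2 + j) (2 + m) , + suc m -ℤ + 0)
Δd-hook j m j≤m =
  trans (Δd-unfold (hook (3 + j) (3 + m)) refl slid)
        (cong₂ _,_ (cong (λ r → twoRow (1 ∷ r) (2 + j)) (pred-without (2 + j) 2 (suc m)))
                   (cong (λ c → + c -ℤ + 0)
                         (length-without-present (3 + j) 3 (suc m) (m≤m+n 3 j) (s≤s (s≤s (s≤s (s≤s j≤m)))))))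
  where
  rest : List ℕ
  rest = without (3 + j) (interval 3 (suc m))
  slid : slide (size (hook (3 + j) (3 + m))) (setEntry (hook (3 + j) (3 + m)) 0 0 0) 0 0
         ≡ (twoRow (2 ∷ rest) (3 + j) , (0 , suc (length rest)))
  slid = slide-along-row rest (suc (length rest + 1)) 0 (2 ∷ []) (3 + j) refl
                         (m≤n⇒m≤1+n (m≤m+n (length rest) 1))

Δ-hook : ∀ j m → j ≤ m → Δ (hook (3 + j) (3 + m)) ≡ hook (2 + j) (2 + m)
Δ-hook j m j≤m = cong proj₁ (Δd-hook j m j≤m)

diag-hook : ∀ j m → j ≤ m → diagRemoved (hook (3 + j) (3 + m)) ≡ + suc m
diag-hook j m j≤m = trans (cong proj₂ (Δd-hook j m j≤m)) (ℤP.+-identityʳ (+ suc m))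

size-Δ-hook : ∀ j m → j ≤ m → size (Δ (hook (3 + j) (3 + m))) ≡ 2 + m
size-Δ-hook j m j≤m = trans (cong size (Δ-hook j m j≤m)) (hook-size (2 + j) (2 + m) (s≤s z≤n) (s≤s (s≤s j≤m)))

rowOf-skip : ∀ y ys rest x → y ≢ x → rowOf ((y ∷ ys) ∷ rest) x ≡ rowOf (ys ∷ rest) x
rowOf-skip y ys rest x y≢x rewrite ≡ᵇ-false y≢x = refl

rowOf-without : ∀ p a m rest x → x < a → rowOf (without p (interval a m) ∷ rest) x ≡ rowOf ([] ∷ rest) x
rowOf-without p a zero    rest x x<a = refl
rowOf-without p a (suc m) rest x x<a with a ≡ᵇ p
... | true  = rowOf-without p (suc a) m rest x (m≤n⇒m≤1+n x<a)
... | false = trans (rowOf-skip a (without p (interval (suc a) m)) rest x (>⇒≢ x<a)) (rowOf-without p (suc a) m rest x (m≤n⇒m≤1+n x<a))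

smallest-ascent-two : ∀ t f → size t ≡ 3 + f →
  (rowOf t 2 ≤ᵇ rowOf t 1) ≡ false → (rowOf t 3 ≤ᵇ rowOf t 2) ≡ true → isDerangement t ≡ true
smallest-ascent-two t f size-t one-descent two-ascent rewrite size-t | size-t | one-descent | two-ascent = refl

-- In t_{2,n} with n ≥ 3, the entry 2 lies above 1 and 3 lies right of 1.
hook-2-derangement : ∀ m → isDerangement (hook 2 (3 + m)) ≡ true
hook-2-derangement m =
  smallest-ascent-two (hook 2 (3 + m)) (length rest)
    (cong (λ s → suc (suc s)) (+-comm (length rest) 1))
    (cong (_≤ᵇ 0) (rowOf-without 2 4 m ((2 ∷ []) ∷ []) 2 (s≤s (s≤s (s≤s z≤n)))))
    refl
  where
  rest : List ℕ
  rest = without 2 (interval 4 m)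

-- type(t_{i,n}) = i - 2: t_{2,n} is a derangement tableau, and for i ≥ 3
-- the tableau t_{i,n} is not (1 is an ascent) while Δ lowers i by one.
hook-type : ∀ j m → j ≤ m → type (hook (2 + j) (2 + m)) ≡ j
hook-type zero    zero    _         = refl
hook-type zero    (suc m) _         = type-derangement (hook 2 (3 + m)) (hook-2-derangement m)
hook-type (suc j) (suc m) (s≤s j≤m) =
  trans (type-step (hook (3 + j) (3 + m)) refl size-drop)
        (cong suc (trans (cong type (Δ-hook j m j≤m)) (hook-type j m j≤m)))
  where
  size-drop : size (hook (3 + j) (3 + m)) ≡ suc (size (Δ (hook (3 + j) (3 + m))))
  size-drop = trans (hook-size (3 + j) (3 + m) (s≤s z≤n) (s≤s (s≤s (s≤s j≤m))))
                    (cong suc (sym (size-Δ-hook j m j≤m)))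

hookValue : ℕ → ℕ → ℕ → ℤ
hookValue k j m = v k (hook (2 + j) (2 + m))

-- The paper's coefficient size + 1 - (k+1) + diag for t_{j+3,m+3}.
hookCoeff : ℕ → ℕ → ℤ
hookCoeff k m = + (3 + m + 1) -ℤ + suc k +ℤ + suc m

hookCoeff-nonneg : ∀ {k m} → k ≤ m → + 0 ≤ℤ hookCoeff k m
hookCoeff-nonneg {k} {m} k≤m =
  ℤP.+-mono-≤ (ℤP.i≤j⇒0≤j-i (+≤+ (s≤s (≤-trans k≤m (m≤n⇒m≤1+n (m≤n⇒m≤1+n (m≤m+n m 1)))))))
              (+≤+ z≤n)

hookValue-zero : ∀ j m → hookValue 0 j m ≡ + 1
hookValue-zero j m = refl

hookValue-base : ∀ k m → hookValue (suc k) 0 m ≡ + 0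
hookValue-base k m = v-vanishes k (hook 2 (2 + m)) (subst (_< suc k) (sym (hook-type 0 m z≤n)) (s≤s z≤n))

hookValue-vanish : ∀ {k j m} → j ≤ m → j < k → hookValue (suc k) (suc j) (suc m) ≡ + 0
hookValue-vanish {k} {j} {m} j≤m j<k =
  v-vanishes k (hook (3 + j) (3 + m)) (subst (_< suc k) (sym (hook-type (suc j) (suc m) (s≤s j≤m))) (s≤s j<k))

hookValue-step : ∀ {k j m} → j ≤ m → k ≤ j →
  hookValue (suc k) (suc j) (suc m) ≡ hookValue (suc k) j m +ℤ hookCoeff k m * hookValue k j m
hookValue-step {k} {j} {m} j≤m k≤j = begin
  v (suc k) t
    ≡⟨ v-recursion k t (hook-size (3 + j) (3 + m) (s≤s z≤n) (s≤s (s≤s (s≤s j≤m))))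
                       (size-Δ-hook j m j≤m) k<type ⟩
  v (suc k) (Δ t) +ℤ (+ (3 + m + 1) -ℤ + suc k +ℤ diagRemoved t) * v k (Δ t)
    ≡⟨ cong₂ (λ u d → v (suc k) u +ℤ (+ (3 + m + 1) -ℤ + suc k +ℤ d) * v k u)
             (Δ-hook j m j≤m) (diag-hook j m j≤m) ⟩
  hookValue (suc k) j m +ℤ hookCoeff k m * hookValue k j m ∎
  where
  open ≡-Reasoning
  t : Tableau
  t = hook (3 + j) (3 + m)
  k<type : suc k ≤ type t
  k<type = subst (suc k ≤_) (sym (hook-type (suc j) (suc m) (s≤s j≤m))) (s≤s k≤j)

open MonotoneRecurrence hookValue hookCoeff hookCoeff-nonneg
  hookValue-zero hookValue-base hookValue-vanish hookValue-step
  using (W-mono)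

proposition90 : (n k : ℕ) → 3 ≤ n → (i : ℕ) → 2 ≤ i → i < n →
    v k (tab i n) ≤ℤ v k (tab (suc i) n)
proposition90 (suc (suc m)) k _ (suc (suc j)) (s≤s (s≤s z≤n)) (s≤s (s≤s 1+j≤m)) =
  subst₂ _≤ℤ_ (cong (v k) (sym (tab≡hook (2 + j) (2 + m))))
              (cong (v k) (sym (tab≡hook (3 + j) (2 + m))))
              (W-mono k j m 1+j≤m)
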